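{- Let $G$ be a finite simple graph with independence number three and reduced independence polynomial $P(z)=I_G(z)-1=a_1z+a_2z^2+a_3z^3$. Then: (1) if $a_1=4$ then $a_2<6$ and $(a_2,a_3)\in\{(3,1),(4,1),(5,2)\}$; (2) if $a_1=5$ then $a_2<9$, and if $a_2=8$ then $a_3=4$; (3) if $a_1=6$ then $a_2<13$, and if $a_2=12$ then $a_3=8$; (4) if $a_1=7$ then $a_2<17$, and if $a_2=16$ then $a_3=12$; (5) if $a_1=8$ then $a_2<22$; if $a_2=21$ then $a_3=18$, and if $a_2=20$ then $a_3\in\{15,16\}$.
   Context: For a finite simple graph $G$, $I_G(z)=\sum_{i=0}^d a_iz^i$ with $a_0=1$ where $a_i$ is the number of independent sets (sets of pairwise non-adjacent vertices) of size $i$ and $d$, the independence number, is the maximum size of an independent set; $a_1$ is the number of vertices. -}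

module Defs where

open import Data.Nat using (ℕ; zero; suc; _≤_)
open import Data.Nat.Properties using (_≟_)
open import Data.Bool using (Bool; true; false)
open import Data.Fin using (Fin)
open import Data.Fin.Subset using (Subset; _∈_; ∣_∣; inside; outside)
open import Data.Fin.Subset.Properties using (_∈?_)
open import Data.Fin.Properties using (all?)
open import Data.Vec using (_∷_; [])
open import Data.List using (List; []; _∷_; _++_; map; filter; length)
open import Data.Product using (∃; _×_; _,_)
open import Relation.Binary.PropositionalEquality using (_≡_)
open import Relation.Nullary using (¬_; Dec; yes; no)
open import Relation.Nullary.Decidable using (_×-dec_; _→-dec_; ¬?)
open import Data.Bool.Properties using () renaming (_≟_ to _≟ᵇ_)

record Graph (n : ℕ) : Set where
  field
    adj    : Fin n → Fin n → Bool
    sym    : ∀ i j → adj i j ≡ adj j i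
    irrefl : ∀ i → adj i i ≡ false

open Graph public

Independent : ∀ {n} → Graph n → Subset n → Set
Independent G S = ∀ i j → i ∈ S → j ∈ S → adj G i j ≡ false

independent? : ∀ {n} (G : Graph n) (S : Subset n) → Dec (Independent G S)
independent? G S =
  all? λ i → all? λ j → (i ∈? S) →-dec ((j ∈? S) →-dec (adj G i j ≟ᵇ false))

allSubsets : (n : ℕ) → List (Subset n)
allSubsets zero = [] ∷ []
allSubsets (suc n) = map (outside ∷_) (allSubsets n) ++ map (inside ∷_) (allSubsets n)

indepCount : ∀ {n} → Graph n → ℕ → ℕ
indepCount {n} G k =
  length (filter (λ S → independent? G S ×-dec (∣ S ∣ ≟ k)) (allSubsets n))

IndependenceNumber : ∀ {n} → Graph n → ℕ → Set
IndependenceNumber G d =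
  (∃ λ S → Independent G S × ∣ S ∣ ≡ d) × (∀ S → Independent G S → ∣ S ∣ ≤ d)

-- Write a₂, a₃ for the numbers of independent pairs and triples. For a vertex v of a graph on
-- s + 1 vertices with α ≤ 3, let d_v be its number of non-neighbours and e_v the number of
-- independent pairs among them. Splitting the independent sets according to whether they contain v
-- gives a₂ = a₂(G − v) + d_v and a₃ = a₃(G − v) + e_v, and double counting gives Σ d_v = 2 a₂ and
-- Σ e_v = 3 a₃. So the possible (a₂, a₃) on s + 1 vertices are constrained by those on at most s
-- vertices: if every (d, e) compatible with the smaller profiles puts q e + p (s − d) strictly on
-- one side of its average over the vertices, the profile does not occur. Proceeding by induction on
-- the number of vertices, a table of admissible a₃-intervals for each a₂, up to 8 vertices, is
-- certified this way by evaluation; the theorem reads off its rows 4 to 8.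
module Submission where

open import Level using (0ℓ)
open import Data.Bool using (Bool; true; false; not; _∧_; T)
open import Data.Bool.Properties using (∧-zeroʳ; T?; T-∧)
open import Data.Empty using (⊥-elim)
open import Data.Fin using (Fin; zero; suc)
open import Data.Fin.Subset using (Subset; inside; outside; _∈_; _∉_; _⊆_; _∩_; _─_; _-_; ∣_∣; ⊥; ⊤; Nonempty)
open import Data.Fin.Subset.Properties
  using (p─⊥≡p; ∣p∩q∣≤∣p∣; ∩-assoc; ∩-comm; ∩-identityʳ; x∈p∩q⁺; x∈p∩q⁻; drop-there; nonempty?;
         Empty-unique; ∣⊥∣≡0; ∣⊤∣≡n; _⊆?_; out⊆-⇔; in⊆in; ⊆⊤)
open import Data.List using (List; []; _∷_; map; filter; length)
open import Data.List.Properties using (filter-++; length-++; filter-≐; filter-none; filter-some)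
open import Data.List.Relation.Unary.All using (universal)
open import Data.List.Relation.Unary.Any using (Any; any?; satisfied) renaming (here to hereₗ)
open import Data.List.Membership.Propositional using (lose) renaming (_∈_ to _∈ₗ_)
open import Data.List.Membership.Propositional.Properties using (∈-map⁺; ∈-++⁺ˡ; ∈-++⁺ʳ)
open import Data.Nat using (ℕ; zero; suc; _+_; _*_; _∸_; _≤_; _<_; _≤ᵇ_; _⊔_; _≤?_; _<?_; z≤n; s≤s)
open import Data.Nat.Properties
  using (_≟_; allUpTo?; +-comm; +-assoc; +-identityʳ; *-zeroʳ; *-distribˡ-+; +-cancelˡ-≡; suc-injective;
         m+n≡0⇒m≡0; m+n≡0⇒n≡0; m+n∸n≡m; m∸n+n≡m; ≤-refl; ≤-reflexive; ≤-trans; ≤-<-trans; <⇒≤; <⇒≱;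
         <-irrefl; m≤m+n; m≤n+m; m≤m⊔n; m≤n⊔m; m≤n⇒m≤1+n; ≤ᵇ⇒≤; +-mono-≤; +-mono-<-≤; +-mono-≤-<;
         +-commutativeSemigroup)
open import Algebra.Properties.CommutativeSemigroup +-commutativeSemigroup using (interchange; xy∙z≈xz∙y)
open import Data.Nat.Tactic.RingSolver using (solve-∀)
open import Data.Product using (_×_; _,_; proj₁; proj₂)
open import Data.Sum using (_⊎_; inj₁; inj₂)
open import Data.Unit using (tt)
open import Data.Vec using ([]; _∷_; tail; tabulate; here; there)
open import Data.Vec.Properties using (lookup∘tabulate; lookup⇒[]=; []=⇒lookup)
open import Function using (_∘_; _$_; Equivalence; case_of_)
open import Relation.Binary.PropositionalEquality
  using (_≡_; refl; sym; trans; cong; cong₂; subst; subst₂; module ≡-Reasoning)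
open import Relation.Nullary using (Dec; yes; no; ¬_; contradiction)
open import Relation.Nullary.Decidable using (True; toWitness; _×-dec_; _⊎-dec_; _→-dec_)
open import Relation.Unary using (Pred; Decidable; _≐_)

open import Defs hiding (sym)

private variable
  n : ℕ

dropFirst : Graph (suc n) → Graph n
dropFirst G = record
  { adj    = λ i j → adj G (suc i) (suc j)
  ; sym    = λ i j → Graph.sym G (suc i) (suc j)
  ; irrefl = λ i → irrefl G (suc i)
  }

-- Contains v itself.
nonNeighbours : Graph n → Fin n → Subset n
nonNeighbours G v = tabulate (λ w → not (adj G v w))

nonNeighbours₀ : Graph (suc n) → Subset n
nonNeighbours₀ G = tail (nonNeighbours G zero)

nonNeighboursIn : Graph n → Subset n → Fin n → Subset n
nonNeighboursIn G A v = (A - v) ∩ nonNeighbours G v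

∈-nonNeighbours⁺ : (G : Graph n) {v w : Fin n} → adj G v w ≡ false → w ∈ nonNeighbours G v
∈-nonNeighbours⁺ G {v} {w} v≁w = lookup⇒[]= w _ (trans (lookup∘tabulate _ w) (cong not v≁w))

∈-nonNeighbours⁻ : (G : Graph n) {v w : Fin n} → w ∈ nonNeighbours G v → adj G v w ≡ false
∈-nonNeighbours⁻ G {v} {w} w∈
  with adj G v w | trans (sym (lookup∘tabulate (λ u → not (adj G v u)) w)) ([]=⇒lookup w∈)
... | false | _ = refl
... | true  | ()

∉-nonNeighbours : (G : Graph n) {v w : Fin n} → adj G v w ≡ true → w ∉ nonNeighbours G v
∉-nonNeighbours G v∼w w∈ with () ← trans (sym v∼w) (∈-nonNeighbours⁻ G w∈)

p∩q∩r≡p∩r∩q : (A B C : Subset n) → (A ∩ B) ∩ C ≡ (A ∩ C) ∩ B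
p∩q∩r≡p∩r∩q A B C = trans (∩-assoc A B C) (trans (cong (A ∩_) (∩-comm B C)) (sym (∩-assoc A C B)))

x∈p⇒suc∣p-x∣≡∣p∣ : {A : Subset n} {v : Fin n} → v ∈ A → suc ∣ A - v ∣ ≡ ∣ A ∣
x∈p⇒suc∣p-x∣≡∣p∣ {A = inside ∷ A} here = cong (suc ∘ ∣_∣) (p─⊥≡p A)
x∈p⇒suc∣p-x∣≡∣p∣ {A = outside ∷ A} (there v∈A) = x∈p⇒suc∣p-x∣≡∣p∣ v∈A
x∈p⇒suc∣p-x∣≡∣p∣ {A = inside ∷ A} (there v∈A) = cong suc (x∈p⇒suc∣p-x∣≡∣p∣ v∈A)

p∩q-x≡p-x∩q : ∀ (A R : Subset n) v → (A ∩ R) - v ≡ (A - v) ∩ R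
p∩q-x≡p-x∩q (x ∷ A) (r ∷ R) zero =
  cong (outside ∷_) (trans (p─⊥≡p (A ∩ R)) (cong (_∩ R) (sym (p─⊥≡p A))))
p∩q-x≡p-x∩q (x ∷ A) (r ∷ R) (suc v) = cong ((x ∧ r) ∷_) (p∩q-x≡p-x∩q A R v)

x∉q⇒p-x∩q≡p∩q : ∀ (A R : Subset n) {v} → v ∉ R → (A - v) ∩ R ≡ A ∩ R
x∉q⇒p-x∩q≡p∩q (x ∷ A) (inside ∷ R) {zero} v∉R = contradiction here v∉R
x∉q⇒p-x∩q≡p∩q (x ∷ A) (outside ∷ R) {zero} v∉R = cong₂ _∷_ (sym (∧-zeroʳ x)) (cong (_∩ R) (p─⊥≡p A))
x∉q⇒p-x∩q≡p∩q (x ∷ A) (r ∷ R) {suc v} v∉R = cong ((x ∧ r) ∷_) (x∉q⇒p-x∩q≡p∩q A R (v∉R ∘ there))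

∣p∩q∣≡∣p∣⇒p∩q≡p : ∀ (A R : Subset n) → ∣ A ∩ R ∣ ≡ ∣ A ∣ → A ∩ R ≡ A
∣p∩q∣≡∣p∣⇒p∩q≡p [] [] _ = refl
∣p∩q∣≡∣p∣⇒p∩q≡p (outside ∷ A) (r ∷ R) eq = cong (outside ∷_) (∣p∩q∣≡∣p∣⇒p∩q≡p A R eq)
∣p∩q∣≡∣p∣⇒p∩q≡p (inside ∷ A) (inside ∷ R) eq = cong (inside ∷_) (∣p∩q∣≡∣p∣⇒p∩q≡p A R (suc-injective eq))
∣p∩q∣≡∣p∣⇒p∩q≡p (inside ∷ A) (outside ∷ R) eq = contradiction (∣p∩q∣≤∣p∣ A R) (<⇒≱ (≤-reflexive (sym eq)))

∣p∣≡suc⇒Nonempty : {A : Subset n} {s : ℕ} → ∣ A ∣ ≡ suc s → Nonempty A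
∣p∣≡suc⇒Nonempty {n} {A} size with nonempty? A
... | yes ne = ne
... | no empty with () ← trans (sym size) (trans (cong ∣_∣ (Empty-unique empty)) (∣⊥∣≡0 n))

indepCountIn : Graph n → Subset n → ℕ → ℕ
indepCountIn G A zero = 1
indepCountIn {zero} G [] (suc k) = 0
indepCountIn {suc n} G (outside ∷ A) (suc k) = indepCountIn (dropFirst G) A (suc k)
indepCountIn {suc n} G (inside ∷ A) (suc k) =
  indepCountIn (dropFirst G) A (suc k) + indepCountIn (dropFirst G) (A ∩ nonNeighbours₀ G) k

indepCountIn-outside : ∀ (G : Graph (suc n)) A k →
  indepCountIn G (outside ∷ A) k ≡ indepCountIn (dropFirst G) A k
indepCountIn-outside G A zero = refl
indepCountIn-outside G A (suc k) = refl

indepCountIn-1 : ∀ (G : Graph n) A → indepCountIn G A 1 ≡ ∣ A ∣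
indepCountIn-1 G [] = refl
indepCountIn-1 G (outside ∷ A) = indepCountIn-1 (dropFirst G) A
indepCountIn-1 G (inside ∷ A) = trans (+-comm _ 1) (cong suc (indepCountIn-1 (dropFirst G) A))

indepCountIn-vanish : ∀ (G : Graph n) A k →
  indepCountIn G A (suc k) ≡ 0 → indepCountIn G A (suc (suc k)) ≡ 0
indepCountIn-vanish G [] k _ = refl
indepCountIn-vanish G (outside ∷ A) k none = indepCountIn-vanish (dropFirst G) A k none
indepCountIn-vanish G (inside ∷ A) zero none = contradiction (trans (+-comm 1 _) none) λ ()
indepCountIn-vanish G (inside ∷ A) (suc k) none = cong₂ _+_
  (indepCountIn-vanish (dropFirst G) A (suc k) (m+n≡0⇒m≡0 _ none))
  (indepCountIn-vanish (dropFirst G) (A ∩ nonNeighbours₀ G) k (m+n≡0⇒n≡0 _ none))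

indepCountIn-∩-≤ : ∀ (G : Graph n) A R k → indepCountIn G (A ∩ R) k ≤ indepCountIn G A k
indepCountIn-∩-≤ G A R zero = ≤-refl
indepCountIn-∩-≤ G [] [] (suc k) = ≤-refl
indepCountIn-∩-≤ G (outside ∷ A) (r ∷ R) (suc k) = indepCountIn-∩-≤ (dropFirst G) A R (suc k)
indepCountIn-∩-≤ G (inside ∷ A) (outside ∷ R) (suc k) =
  ≤-trans (indepCountIn-∩-≤ (dropFirst G) A R (suc k)) (m≤m+n _ _)
indepCountIn-∩-≤ G (inside ∷ A) (inside ∷ R) (suc k) = +-mono-≤
  (indepCountIn-∩-≤ (dropFirst G) A R (suc k))
  (subst (_≤ indepCountIn (dropFirst G) (A ∩ N₀) k)
     (cong (λ B → indepCountIn (dropFirst G) B k) (p∩q∩r≡p∩r∩q A N₀ R))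
     (indepCountIn-∩-≤ (dropFirst G) (A ∩ N₀) R k))
  where N₀ = nonNeighbours₀ G

indepCountIn-delete : ∀ (G : Graph n) {A v} → v ∈ A → ∀ k →
  indepCountIn G A (suc k) ≡ indepCountIn G (A - v) (suc k) + indepCountIn G (nonNeighboursIn G A v) k
indepCountIn-delete G {inside ∷ A} here k = sym (cong₂ _+_
  (cong (λ B → indepCountIn (dropFirst G) B (suc k)) (p─⊥≡p A))
  (trans (indepCountIn-outside G _ k)
         (cong (λ B → indepCountIn (dropFirst G) (B ∩ nonNeighbours₀ G) k) (p─⊥≡p A))))
indepCountIn-delete G {outside ∷ A} {suc v} (there v∈A) k =
  trans (indepCountIn-delete (dropFirst G) v∈A k)
        (cong (indepCountIn (dropFirst G) (A - v) (suc k) +_) (sym (indepCountIn-outside G _ k)))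
indepCountIn-delete G {inside ∷ A} (there v∈A) zero = cong (_+ 1) (indepCountIn-delete (dropFirst G) v∈A zero)
indepCountIn-delete G {inside ∷ A} {suc v} (there v∈A) (suc k) with adj G (suc v) zero in v∼0
... | false = begin
    c A (2 + k) + c (A ∩ N₀) (1 + k)
  ≡⟨ cong₂ _+_ (indepCountIn-delete G′ v∈A (suc k)) (indepCountIn-delete G′ v∈A∩N₀ k) ⟩
    (c (A - v) (2 + k) + c ((A - v) ∩ N v) (1 + k)) + (c ((A ∩ N₀) - v) (1 + k) + c (((A ∩ N₀) - v) ∩ N v) k)
  ≡⟨ cong₂ (λ B B′ → c (A - v) (2 + k) + c ((A - v) ∩ N v) (1 + k) + (c B (1 + k) + c B′ k))
       (p∩q-x≡p-x∩q A N₀ v) (trans (cong (_∩ N v) (p∩q-x≡p-x∩q A N₀ v)) (p∩q∩r≡p∩r∩q (A - v) N₀ (N v))) ⟩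
    (c (A - v) (2 + k) + c ((A - v) ∩ N v) (1 + k)) + (c ((A - v) ∩ N₀) (1 + k) + c (((A - v) ∩ N v) ∩ N₀) k)
  ≡⟨ interchange (c (A - v) (2 + k)) (c ((A - v) ∩ N v) (1 + k)) _ _ ⟩
    (c (A - v) (2 + k) + c ((A - v) ∩ N₀) (1 + k)) + (c ((A - v) ∩ N v) (1 + k) + c (((A - v) ∩ N v) ∩ N₀) k)
  ∎
  where
  open ≡-Reasoning
  G′ = dropFirst G
  c = indepCountIn G′
  N = nonNeighbours G′
  N₀ = nonNeighbours₀ G
  v∈A∩N₀ : v ∈ A ∩ N₀
  v∈A∩N₀ = x∈p∩q⁺ (v∈A , drop-there (∈-nonNeighbours⁺ G (trans (Graph.sym G zero (suc v)) v∼0)))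
... | true = begin
    c A (2 + k) + c (A ∩ N₀) (1 + k)
  ≡⟨ cong₂ _+_ (indepCountIn-delete G′ v∈A (suc k))
               (cong (λ B → c B (1 + k)) (sym (x∉q⇒p-x∩q≡p∩q A N₀ v∉N₀))) ⟩
    (c (A - v) (2 + k) + c ((A - v) ∩ N v) (1 + k)) + c ((A - v) ∩ N₀) (1 + k)
  ≡⟨ xy∙z≈xz∙y (c (A - v) (2 + k)) (c ((A - v) ∩ N v) (1 + k)) _ ⟩
    (c (A - v) (2 + k) + c ((A - v) ∩ N₀) (1 + k)) + c ((A - v) ∩ N v) (1 + k)
  ∎
  where
  open ≡-Reasoning
  G′ = dropFirst G
  c = indepCountIn G′
  N = nonNeighbours G′
  N₀ = nonNeighbours₀ G
  v∉N₀ : v ∉ N₀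
  v∉N₀ = ∉-nonNeighbours G (trans (Graph.sym G zero (suc v)) v∼0) ∘ there

sumOver : Subset n → (Fin n → ℕ) → ℕ
sumOver [] f = 0
sumOver (outside ∷ A) f = sumOver A (f ∘ suc)
sumOver (inside ∷ A) f = f zero + sumOver A (f ∘ suc)

sumOver-cong : ∀ (A : Subset n) {f g} → (∀ {v} → v ∈ A → f v ≡ g v) → sumOver A f ≡ sumOver A g
sumOver-cong [] f≗g = refl
sumOver-cong (outside ∷ A) f≗g = sumOver-cong A (f≗g ∘ there)
sumOver-cong (inside ∷ A) f≗g = cong₂ _+_ (f≗g here) (sumOver-cong A (f≗g ∘ there))

sumOver-mono-≤ : ∀ (A : Subset n) {f g} → (∀ {v} → v ∈ A → f v ≤ g v) → sumOver A f ≤ sumOver A g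
sumOver-mono-≤ [] f≤g = z≤n
sumOver-mono-≤ (outside ∷ A) f≤g = sumOver-mono-≤ A (f≤g ∘ there)
sumOver-mono-≤ (inside ∷ A) f≤g = +-mono-≤ (f≤g here) (sumOver-mono-≤ A (f≤g ∘ there))

sumOver-mono-< : ∀ (A : Subset n) {f g} → Nonempty A → (∀ {v} → v ∈ A → f v < g v) →
  sumOver A f < sumOver A g
sumOver-mono-< (inside ∷ A) (zero , here) f<g =
  +-mono-<-≤ (f<g here) (sumOver-mono-≤ A (<⇒≤ ∘ f<g ∘ there))
sumOver-mono-< (outside ∷ A) (suc v , there v∈A) f<g = sumOver-mono-< A (v , v∈A) (f<g ∘ there)
sumOver-mono-< (inside ∷ A) (suc v , there v∈A) f<g =
  +-mono-≤-< (<⇒≤ (f<g here)) (sumOver-mono-< A (v , v∈A) (f<g ∘ there))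

sumOver-+ : ∀ (A : Subset n) f g → sumOver A (λ v → f v + g v) ≡ sumOver A f + sumOver A g
sumOver-+ [] f g = refl
sumOver-+ (outside ∷ A) f g = sumOver-+ A (f ∘ suc) (g ∘ suc)
sumOver-+ (inside ∷ A) f g = trans (cong (f zero + g zero +_) (sumOver-+ A (f ∘ suc) (g ∘ suc)))
  (interchange (f zero) (g zero) _ _)

*-distribˡ-sumOver : ∀ c (A : Subset n) f → c * sumOver A f ≡ sumOver A (λ v → c * f v)
*-distribˡ-sumOver c [] f = *-zeroʳ c
*-distribˡ-sumOver c (outside ∷ A) f = *-distribˡ-sumOver c A (f ∘ suc)
*-distribˡ-sumOver c (inside ∷ A) f =
  trans (*-distribˡ-+ c (f zero) _) (cong (c * f zero +_) (*-distribˡ-sumOver c A (f ∘ suc)))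

sumOver-const : ∀ (A : Subset n) c → sumOver A (λ _ → c) ≡ ∣ A ∣ * c
sumOver-const [] c = refl
sumOver-const (outside ∷ A) c = sumOver-const A c
sumOver-const (inside ∷ A) c = cong (c +_) (sumOver-const A c)

¬-all-above-mean : ∀ (A : Subset n) f → Nonempty A → ¬ (∀ {v} → v ∈ A → sumOver A f < ∣ A ∣ * f v)
¬-all-above-mean A f ne above = <-irrefl
  (trans (sumOver-const A (sumOver A f)) (*-distribˡ-sumOver ∣ A ∣ A f))
  (sumOver-mono-< A ne above)

¬-all-below-mean : ∀ (A : Subset n) f → Nonempty A → ¬ (∀ {v} → v ∈ A → ∣ A ∣ * f v < sumOver A f)
¬-all-below-mean A f ne below = <-irrefl
  (sym (trans (sumOver-const A (sumOver A f)) (*-distribˡ-sumOver ∣ A ∣ A f)))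
  (sumOver-mono-< A ne below)

-- Each independent k-subset of A ∩ R lies in (A − v) ∩ R for exactly ∣ A ∣ − k vertices v of A
-- (stated without subtraction).
sumOver-indepCountIn-delete-∩ : ∀ (G : Graph n) A R k →
  sumOver A (λ v → indepCountIn G ((A - v) ∩ R) k) + k * indepCountIn G (A ∩ R) k ≡
  ∣ A ∣ * indepCountIn G (A ∩ R) k
sumOver-indepCountIn-delete-∩ G A R zero = trans (+-identityʳ _) (sumOver-const A 1)
sumOver-indepCountIn-delete-∩ G [] [] (suc k) = *-zeroʳ (suc k)
sumOver-indepCountIn-delete-∩ G (outside ∷ A) (r ∷ R) (suc k) =
  sumOver-indepCountIn-delete-∩ (dropFirst G) A R (suc k)
sumOver-indepCountIn-delete-∩ G (inside ∷ A) (outside ∷ R) (suc k) = begin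
    c ((A ─ ⊥) ∩ R) (suc k) + Σ + suc k * c (A ∩ R) (suc k)
  ≡⟨ cong (λ B → c (B ∩ R) (suc k) + Σ + suc k * c (A ∩ R) (suc k)) (p─⊥≡p A) ⟩
    c (A ∩ R) (suc k) + Σ + suc k * c (A ∩ R) (suc k)
  ≡⟨ +-assoc (c (A ∩ R) (suc k)) Σ _ ⟩
    c (A ∩ R) (suc k) + (Σ + suc k * c (A ∩ R) (suc k))
  ≡⟨ cong (c (A ∩ R) (suc k) +_) (sumOver-indepCountIn-delete-∩ (dropFirst G) A R (suc k)) ⟩
    c (A ∩ R) (suc k) + ∣ A ∣ * c (A ∩ R) (suc k)
  ∎
  where
  open ≡-Reasoning
  c = indepCountIn (dropFirst G)
  Σ = sumOver A (λ v → c ((A - v) ∩ R) (suc k))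
sumOver-indepCountIn-delete-∩ G (inside ∷ A) (inside ∷ R) (suc k) = begin
    c ((A ─ ⊥) ∩ R) (suc k) + sumOver A (λ v → c ((A - v) ∩ R) (suc k) + c (((A - v) ∩ R) ∩ N₀) k)
      + suc k * (c₁ + c₂)
  ≡⟨ cong₂ (λ x y → x + y + suc k * (c₁ + c₂))
       (cong (λ B → c (B ∩ R) (suc k)) (p─⊥≡p A)) (sumOver-+ A _ _) ⟩
    c₁ + (Σ₁ + Σ₂) + suc k * (c₁ + c₂)
  ≡⟨ regroup c₁ c₂ Σ₁ Σ₂ k ⟩
    c₁ + c₂ + (Σ₁ + suc k * c₁) + (Σ₂ + k * c₂)
  ≡⟨ cong₂ (λ x y → c₁ + c₂ + x + y) (sumOver-indepCountIn-delete-∩ (dropFirst G) A R (suc k)) ih₂ ⟩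
    c₁ + c₂ + ∣ A ∣ * c₁ + ∣ A ∣ * c₂
  ≡⟨ collect c₁ c₂ ∣ A ∣ ⟩
    suc ∣ A ∣ * (c₁ + c₂)
  ∎
  where
  open ≡-Reasoning
  c = indepCountIn (dropFirst G)
  N₀ = nonNeighbours₀ G
  c₁ = c (A ∩ R) (suc k)
  c₂ = c ((A ∩ R) ∩ N₀) k
  Σ₁ = sumOver A (λ v → c ((A - v) ∩ R) (suc k))
  Σ₂ = sumOver A (λ v → c (((A - v) ∩ R) ∩ N₀) k)
  regroup : ∀ c₁ c₂ Σ₁ Σ₂ k →
    c₁ + (Σ₁ + Σ₂) + suc k * (c₁ + c₂) ≡ c₁ + c₂ + (Σ₁ + suc k * c₁) + (Σ₂ + k * c₂)
  regroup = solve-∀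
  collect : ∀ c₁ c₂ a → c₁ + c₂ + a * c₁ + a * c₂ ≡ suc a * (c₁ + c₂)
  collect = solve-∀
  ih₂ : Σ₂ + k * c₂ ≡ ∣ A ∣ * c₂
  ih₂ = begin
      Σ₂ + k * c₂
    ≡⟨ cong₂ _+_ (sumOver-cong A λ {v} _ → cong (λ B → c B k) (∩-assoc (A - v) R N₀))
                 (cong (λ B → k * c B k) (∩-assoc A R N₀)) ⟩
      sumOver A (λ v → c ((A - v) ∩ (R ∩ N₀)) k) + k * c (A ∩ (R ∩ N₀)) k
    ≡⟨ sumOver-indepCountIn-delete-∩ (dropFirst G) A (R ∩ N₀) k ⟩
      ∣ A ∣ * c (A ∩ (R ∩ N₀)) k
    ≡⟨ cong (λ B → ∣ A ∣ * c B k) (∩-assoc A R N₀) ⟨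
      ∣ A ∣ * c₂
    ∎

sumOver-indepCountIn-delete : ∀ (G : Graph n) A k →
  sumOver A (λ v → indepCountIn G (A - v) k) + k * indepCountIn G A k ≡ ∣ A ∣ * indepCountIn G A k
sumOver-indepCountIn-delete G A k = begin
    sumOver A (λ v → c (A - v) k) + k * c A k
  ≡⟨ cong₂ _+_ (sumOver-cong A λ {v} _ → cong (λ B → c B k) (∩-identityʳ (A - v)))
               (cong (λ B → k * c B k) (∩-identityʳ A)) ⟨
    sumOver A (λ v → c ((A - v) ∩ ⊤) k) + k * c (A ∩ ⊤) k
  ≡⟨ sumOver-indepCountIn-delete-∩ G A ⊤ k ⟩
    ∣ A ∣ * c (A ∩ ⊤) k
  ≡⟨ cong (λ B → ∣ A ∣ * c B k) (∩-identityʳ A) ⟩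
    ∣ A ∣ * c A k
  ∎
  where
  open ≡-Reasoning
  c = indepCountIn G

sumOver-indepCountIn-nonNeighboursIn : ∀ (G : Graph n) A k →
  sumOver A (λ v → indepCountIn G (nonNeighboursIn G A v) k) ≡ suc k * indepCountIn G A (suc k)
sumOver-indepCountIn-nonNeighboursIn G A k = +-cancelˡ-≡ (sumOver A (λ v → c (A - v) (suc k))) _ _ (begin
    sumOver A (λ v → c (A - v) (suc k)) + sumOver A (λ v → c (nonNeighboursIn G A v) k)
  ≡⟨ sumOver-+ A _ _ ⟨
    sumOver A (λ v → c (A - v) (suc k) + c (nonNeighboursIn G A v) k)
  ≡⟨ sumOver-cong A (λ v∈A → indepCountIn-delete G v∈A k) ⟨
    sumOver A (λ _ → c A (suc k))
  ≡⟨ sumOver-const A _ ⟩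
    ∣ A ∣ * c A (suc k)
  ≡⟨ sumOver-indepCountIn-delete G A (suc k) ⟨
    sumOver A (λ v → c (A - v) (suc k)) + suc k * c A (suc k)
  ∎)
  where
  open ≡-Reasoning
  c = indepCountIn G

-- Row s lists, for a₂ = 0, 1, …, the interval of a₃ possible for a graph on s vertices with α ≤ 3
-- (an over-approximation, certified level by level below); a₂ past the end of the row is impossible.
a₃Ranges : ℕ → List (ℕ × ℕ)
a₃Ranges 0 = (0 , 0) ∷ []
a₃Ranges 1 = (0 , 0) ∷ []
a₃Ranges 2 = (0 , 0) ∷ (0 , 0) ∷ []
a₃Ranges 3 = (0 , 0) ∷ (0 , 0) ∷ (0 , 0) ∷ (1 , 1) ∷ []
a₃Ranges 4 = (0 , 0) ∷ (0 , 0) ∷ (0 , 0) ∷ (0 , 1) ∷ (0 , 1) ∷ (2 , 2) ∷ []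
a₃Ranges 5 = (0 , 0) ∷ (0 , 0) ∷ (0 , 0) ∷ (0 , 1) ∷ (0 , 1) ∷ (0 , 2) ∷ (0 , 2) ∷ (2 , 3) ∷ (4 , 4) ∷ []
a₃Ranges 6 = (0 , 13) ∷ (0 , 13) ∷ (0 , 13) ∷ (0 , 13) ∷ (0 , 13) ∷ (0 , 13) ∷ (0 , 13) ∷ (0 , 13) ∷ (0 , 13) ∷
             (0 , 13) ∷ (3 , 5) ∷ (6 , 6) ∷ (8 , 8) ∷ []
a₃Ranges 7 = (0 , 26) ∷ (0 , 26) ∷ (0 , 26) ∷ (0 , 26) ∷ (0 , 26) ∷ (0 , 26) ∷ (0 , 26) ∷ (0 , 26) ∷ (0 , 26) ∷
             (0 , 26) ∷ (0 , 26) ∷ (0 , 26) ∷ (0 , 26) ∷ (3 , 8) ∷ (6 , 9) ∷ (9 , 10) ∷ (12 , 12) ∷ []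
a₃Ranges 8 = (0 , 43) ∷ (0 , 43) ∷ (0 , 43) ∷ (0 , 43) ∷ (0 , 43) ∷ (0 , 43) ∷ (0 , 43) ∷ (0 , 43) ∷ (0 , 43) ∷
             (0 , 43) ∷ (0 , 43) ∷ (0 , 43) ∷ (0 , 43) ∷ (0 , 43) ∷ (0 , 43) ∷ (0 , 43) ∷ (0 , 43) ∷ (0 , 43) ∷
             (0 , 43) ∷ (0 , 43) ∷ (15 , 16) ∷ (18 , 18) ∷ []
a₃Ranges _ = []

inRanges : List (ℕ × ℕ) → ℕ → ℕ → Bool
inRanges [] x y = false
inRanges ((lo , hi) ∷ rs) zero y = (lo ≤ᵇ y) ∧ (y ≤ᵇ hi)
inRanges (_ ∷ rs) (suc x) y = inRanges rs x y

Admissible : ℕ → ℕ → ℕ → Set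
Admissible s a₂ a₃ = T (inRanges (a₃Ranges s) a₂ a₃)

maxHi : List (ℕ × ℕ) → ℕ
maxHi [] = 0
maxHi ((lo , hi) ∷ rs) = hi ⊔ maxHi rs

inRanges-bounded : ∀ rs x y → T (inRanges rs x y) → x < length rs × y ≤ maxHi rs
inRanges-bounded ((lo , hi) ∷ rs) zero y y∈ =
  s≤s z≤n , ≤-trans (≤ᵇ⇒≤ y hi (proj₂ (Equivalence.to T-∧ y∈))) (m≤m⊔n hi (maxHi rs))
inRanges-bounded ((lo , hi) ∷ rs) (suc x) y y∈ with inRanges-bounded rs x y y∈
... | x< , y≤ = s≤s x< , ≤-trans y≤ (m≤n⊔m hi (maxHi rs))

-- The constraints on (d, e) = (∣ nonNeighboursIn G A v ∣, its a₂) for a vertex v of a set A of s + 1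
-- vertices with profile (a₂, a₃): deleting v leaves the profile (a₂ ∸ d, a₃ ∸ e) on s vertices, the
-- non-neighbourhood has no independent triple (with v it would give a 4-set), and if it has all s
-- vertices then it is A − v.
VertexProfile : (s a₂ a₃ d e : ℕ) → Set
VertexProfile s a₂ a₃ d e =
  d ≤ a₂ × Admissible s (a₂ ∸ d) (a₃ ∸ e) × Admissible d e 0 × (d ≡ s → e ≡ a₂ ∸ d × a₃ ∸ e ≡ 0)

vertexProfile? : ∀ s a₂ a₃ d e → Dec (VertexProfile s a₂ a₃ d e)
vertexProfile? s a₂ a₃ d e =
  d ≤? a₂ ×-dec T? _ ×-dec T? _ ×-dec ((d ≟ s) →-dec ((e ≟ a₂ ∸ d) ×-dec (a₃ ∸ e ≟ 0)))

weights : List (ℕ × ℕ)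
weights = (1 , 0) ∷ (0 , 1) ∷ (1 , 1) ∷ (2 , 1) ∷ (3 , 1) ∷ (1 , 2) ∷ (3 , 2) ∷ (4 , 1) ∷ (5 , 2) ∷ []

-- Since Σ d = 2 a₂ and Σ e = 3 a₃, the weights of the s + 1 vertices sum to total.
weight : ℕ × ℕ → (s d e : ℕ) → ℕ
weight (p , q) s d e = q * e + p * (s ∸ d)

total : ℕ × ℕ → (s a₂ a₃ : ℕ) → ℕ
total (p , q) s a₂ a₃ = q * (3 * a₃) + p * (suc s * s ∸ 2 * a₂)

EveryProfile : (s a₂ a₃ : ℕ) → (ℕ → ℕ → Set) → Set
EveryProfile s a₂ a₃ P = ∀ {d} → d < suc s → ∀ {e} → e < suc a₃ → VertexProfile s a₂ a₃ d e → P d e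

everyProfile? : ∀ s a₂ a₃ {P : ℕ → ℕ → Set} → (∀ d e → Dec (P d e)) → Dec (EveryProfile s a₂ a₃ P)
everyProfile? s a₂ a₃ P? =
  allUpTo? (λ d → allUpTo? (λ e → vertexProfile? s a₂ a₃ d e →-dec P? d e) (suc a₃)) (suc s)

Refuted : (s a₂ a₃ : ℕ) → Set
Refuted s a₂ a₃ = Any (λ w → EveryProfile s a₂ a₃ (λ d e → total w s a₂ a₃ < suc s * weight w s d e)
                          ⊎ EveryProfile s a₂ a₃ (λ d e → suc s * weight w s d e < total w s a₂ a₃)) weights

refuted? : ∀ s a₂ a₃ → Dec (Refuted s a₂ a₃)
refuted? s a₂ a₃ =
  any? (λ w → everyProfile? s a₂ a₃ (λ d e → _ <? _) ⊎-dec everyProfile? s a₂ a₃ (λ d e → _ <? _)) weights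

-- The box is where a₂ = a₂(A − v) + d and a₃ = a₃(A − v) + e can lie, given the row-s bounds for
-- A − v, d ≤ s and e ≤ a₂(A − v).
LevelCertificate : ℕ → Set
LevelCertificate s =
  ∀ {a₂} → a₂ < length (a₃Ranges s) + s → ∀ {a₃} → a₃ < maxHi (a₃Ranges s) + length (a₃Ranges s) →
  Admissible (suc s) a₂ a₃ ⊎ Refuted s a₂ a₃

levelCertificate? : ∀ s → Dec (LevelCertificate s)
levelCertificate? s = allUpTo? (λ a₂ → allUpTo? (λ a₃ → T? _ ⊎-dec refuted? s a₂ a₃) _) _

levelCertificate : ∀ s → s < 8 → LevelCertificate s
levelCertificate 0 _ = toWitness {a? = levelCertificate? 0} _
levelCertificate 1 _ = toWitness {a? = levelCertificate? 1} _
levelCertificate 2 _ = toWitness {a? = levelCertificate? 2} _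
levelCertificate 3 _ = toWitness {a? = levelCertificate? 3} _
levelCertificate 4 _ = toWitness {a? = levelCertificate? 4} _
levelCertificate 5 _ = toWitness {a? = levelCertificate? 5} _
levelCertificate 6 _ = toWitness {a? = levelCertificate? 6} _
levelCertificate 7 _ = toWitness {a? = levelCertificate? 7} _
levelCertificate (suc (suc (suc (suc (suc (suc (suc (suc _))))))))
  (s≤s (s≤s (s≤s (s≤s (s≤s (s≤s (s≤s (s≤s ()))))))))

ProfilesAdmissibleUpTo : ℕ → Set
ProfilesAdmissibleUpTo s = ∀ {n} (G : Graph n) A → ∣ A ∣ ≤ s → indepCountIn G A 4 ≡ 0 →
  Admissible ∣ A ∣ (indepCountIn G A 2) (indepCountIn G A 3)

module LevelUp {s} (ih : ProfilesAdmissibleUpTo s) {n} (G : Graph n) {A : Subset n}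
               (∣A∣≡1+s : ∣ A ∣ ≡ suc s) (α≤3 : indepCountIn G A 4 ≡ 0) where

  private
    c = indepCountIn G
    a₂ = c A 2
    a₃ = c A 3
    link : Fin n → Subset n
    link = nonNeighboursIn G A
    d e : Fin n → ℕ
    d v = ∣ link v ∣
    e v = c (link v) 2

  module _ {v} (v∈A : v ∈ A) where
    private
      split : ∀ k → c A (suc k) ≡ c (A - v) (suc k) + c (link v) k
      split = indepCountIn-delete G v∈A
      ∣A-v∣≡s : ∣ A - v ∣ ≡ s
      ∣A-v∣≡s = suc-injective (trans (x∈p⇒suc∣p-x∣≡∣p∣ v∈A) ∣A∣≡1+s)
      d≤∣A-v∣ : d v ≤ ∣ A - v ∣
      d≤∣A-v∣ = ∣p∩q∣≤∣p∣ (A - v) (nonNeighbours G v)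
      link-no3 : c (link v) 3 ≡ 0
      link-no3 = m+n≡0⇒n≡0 (c (A - v) 4) (trans (sym (split 3)) α≤3)

    a₂≡ : a₂ ≡ c (A - v) 2 + d v
    a₂≡ = trans (split 1) (cong (c (A - v) 2 +_) (indepCountIn-1 G (link v)))

    a₃≡ : a₃ ≡ c (A - v) 3 + e v
    a₃≡ = split 2

    d≤s : d v ≤ s
    d≤s = ≤-trans d≤∣A-v∣ (≤-reflexive ∣A-v∣≡s)

    e≤a₃ : e v ≤ a₃
    e≤a₃ = subst (e v ≤_) (sym a₃≡) (m≤n+m (e v) _)

    deletion-admissible : Admissible s (c (A - v) 2) (c (A - v) 3)
    deletion-admissible = subst (λ t → Admissible t _ _) ∣A-v∣≡s
      (ih G (A - v) (≤-reflexive ∣A-v∣≡s) (m+n≡0⇒m≡0 _ (trans (sym (split 3)) α≤3)))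

    link-admissible : Admissible (d v) (e v) 0
    link-admissible = subst (Admissible (d v) (e v)) link-no3
      (ih G (link v) d≤s (indepCountIn-vanish G (link v) 2 link-no3))

    e≤deletion : e v ≤ c (A - v) 2
    e≤deletion = indepCountIn-∩-≤ G (A - v) (nonNeighbours G v) 2

    private
      a₂∸d≡ : a₂ ∸ d v ≡ c (A - v) 2
      a₂∸d≡ = trans (cong (_∸ d v) a₂≡) (m+n∸n≡m _ (d v))
      a₃∸e≡ : a₃ ∸ e v ≡ c (A - v) 3
      a₃∸e≡ = trans (cong (_∸ e v) a₃≡) (m+n∸n≡m _ (e v))
      link≡deletion⇒ : d v ≡ s → e v ≡ a₂ ∸ d v × a₃ ∸ e v ≡ 0
      link≡deletion⇒ d≡s =
        trans (cong (λ B → c B 2) link≡) (sym a₂∸d≡) ,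
        trans a₃∸e≡ (trans (cong (λ B → c B 3) (sym link≡)) link-no3)
        where
        link≡ : link v ≡ A - v
        link≡ = ∣p∩q∣≡∣p∣⇒p∩q≡p (A - v) (nonNeighbours G v) (trans d≡s (sym ∣A-v∣≡s))

    vertexProfile : VertexProfile s a₂ a₃ (d v) (e v)
    vertexProfile =
      subst (d v ≤_) (sym a₂≡) (m≤n+m (d v) _) ,
      subst₂ (Admissible s) (sym a₂∸d≡) (sym a₃∸e≡) deletion-admissible ,
      link-admissible ,
      link≡deletion⇒

  private
    sum-d : sumOver A d ≡ 2 * a₂
    sum-d = trans (sumOver-cong A (λ {v} _ → sym (indepCountIn-1 G (link v))))
                  (sumOver-indepCountIn-nonNeighboursIn G A 1)

    sum-s∸d : sumOver A (λ v → s ∸ d v) ≡ suc s * s ∸ 2 * a₂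
    sum-s∸d = trans (sym (m+n∸n≡m _ (2 * a₂))) (cong (_∸ 2 * a₂) (begin
        sumOver A (λ v → s ∸ d v) + 2 * a₂
      ≡⟨ cong (sumOver A (λ v → s ∸ d v) +_) sum-d ⟨
        sumOver A (λ v → s ∸ d v) + sumOver A d
      ≡⟨ sumOver-+ A _ d ⟨
        sumOver A (λ v → s ∸ d v + d v)
      ≡⟨ sumOver-cong A (λ v∈A → m∸n+n≡m (d≤s v∈A)) ⟩
        sumOver A (λ _ → s)
      ≡⟨ sumOver-const A s ⟩
        ∣ A ∣ * s
      ≡⟨ cong (_* s) ∣A∣≡1+s ⟩
        suc s * s
      ∎))
      where open ≡-Reasoning

    sum-weight : ∀ w → sumOver A (λ v → weight w s (d v) (e v)) ≡ total w s a₂ a₃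
    sum-weight (p , q) = trans (sumOver-+ A _ _) (cong₂ _+_
      (trans (sym (*-distribˡ-sumOver q A e)) (cong (q *_) (sumOver-indepCountIn-nonNeighboursIn G A 2)))
      (trans (sym (*-distribˡ-sumOver p A (λ v → s ∸ d v))) (cong (p *_) sum-s∸d)))

    in-box : a₂ < length (a₃Ranges s) + s × a₃ < maxHi (a₃Ranges s) + length (a₃Ranges s)
    in-box =
      let v , v∈A = ∣p∣≡suc⇒Nonempty ∣A∣≡1+s
          x< , y≤ = inRanges-bounded (a₃Ranges s) _ _ (deletion-admissible v∈A)
      in
      subst (_< _) (sym (a₂≡ v∈A)) (+-mono-<-≤ x< (d≤s v∈A)) ,
      subst (_< _) (sym (a₃≡ v∈A)) (+-mono-≤-< y≤ (≤-<-trans (e≤deletion v∈A) x<))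

    at-vertex : ∀ {P} → EveryProfile s a₂ a₃ P → ∀ {v} → v ∈ A → P (d v) (e v)
    at-vertex every v∈A = every (s≤s (d≤s v∈A)) (s≤s (e≤a₃ v∈A)) (vertexProfile v∈A)

  admissible : LevelCertificate s → Admissible (suc s) a₂ a₃
  admissible certificate with certificate (proj₁ in-box) (proj₂ in-box)
  ... | inj₁ ok = ok
  ... | inj₂ refuted with w , below-or-above ← satisfied refuted with below-or-above
  ... | inj₁ above = ⊥-elim $ ¬-all-above-mean A f (∣p∣≡suc⇒Nonempty ∣A∣≡1+s) λ {v} v∈A →
    subst₂ _<_ (sym (sum-weight w)) (cong (_* f v) (sym ∣A∣≡1+s)) (at-vertex above v∈A)
    where f = λ v → weight w s (d v) (e v)
  ... | inj₂ below = ⊥-elim $ ¬-all-below-mean A f (∣p∣≡suc⇒Nonempty ∣A∣≡1+s) λ {v} v∈A →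
    subst₂ _<_ (cong (_* f v) (sym ∣A∣≡1+s)) (sym (sum-weight w)) (at-vertex below v∈A)
    where f = λ v → weight w s (d v) (e v)

profiles-admissible : ∀ s → s ≤ 8 → ProfilesAdmissibleUpTo s
profiles-admissible s s≤8 G A ∣A∣≤s α≤3 with ∣ A ∣ in ∣A∣≡
... | zero = subst₂ (Admissible 0) (sym no2) (sym (indepCountIn-vanish G A 1 no2)) tt
  where no2 = indepCountIn-vanish G A 0 (trans (indepCountIn-1 G A) ∣A∣≡)
profiles-admissible zero _ G A () α≤3 | suc t
profiles-admissible (suc s) (s≤s s≤7) G A (s≤s t≤s) α≤3 | suc t =
  LevelUp.admissible (λ G′ B ∣B∣≤t → profiles-admissible s (m≤n⇒m≤1+n s≤7) G′ B (≤-trans ∣B∣≤t t≤s))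
    G ∣A∣≡ α≤3 (levelCertificate t (s≤s (≤-trans t≤s s≤7)))

length-filter-map : ∀ {A B : Set} {P : Pred B 0ℓ} (P? : Decidable P) (f : A → B) xs →
  length (filter P? (map f xs)) ≡ length (filter (P? ∘ f) xs)
length-filter-map P? f [] = refl
length-filter-map P? f (x ∷ xs) with P? (f x)
... | yes _ = cong suc (length-filter-map P? f xs)
... | no _ = length-filter-map P? f xs

length-filter-allSubsets : ∀ n {P : Pred (Subset (suc n)) 0ℓ} (P? : Decidable P) →
  length (filter P? (allSubsets (suc n))) ≡
  length (filter (P? ∘ (outside ∷_)) (allSubsets n)) + length (filter (P? ∘ (inside ∷_)) (allSubsets n))
length-filter-allSubsets n P? =
  trans (cong length (filter-++ P? (map (outside ∷_) (allSubsets n)) _))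
  (trans (length-++ (filter P? (map (outside ∷_) (allSubsets n))))
         (cong₂ _+_ (length-filter-map P? (outside ∷_) (allSubsets n))
                    (length-filter-map P? (inside ∷_) (allSubsets n))))

∈-allSubsets : ∀ (S : Subset n) → S ∈ₗ allSubsets n
∈-allSubsets [] = hereₗ refl
∈-allSubsets (outside ∷ S) = ∈-++⁺ˡ (∈-map⁺ (outside ∷_) (∈-allSubsets S))
∈-allSubsets {suc n} (inside ∷ S) =
  ∈-++⁺ʳ (map (outside ∷_) (allSubsets n)) (∈-map⁺ (inside ∷_) (∈-allSubsets S))

length-filter-none : ∀ {A : Set} {P : Pred A 0ℓ} (P? : Decidable P) → (∀ x → ¬ P x) → ∀ xs →
  length (filter P? xs) ≡ 0
length-filter-none P? none xs = cong length (filter-none P? (universal none xs))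

IndepSubsetOf : Graph n → Subset n → ℕ → Subset n → Set
IndepSubsetOf G A k S = S ⊆ A × Independent G S × ∣ S ∣ ≡ k

indepSubsetOf? : ∀ (G : Graph n) A k → Decidable (IndepSubsetOf G A k)
indepSubsetOf? G A k S = S ⊆? A ×-dec independent? G S ×-dec ∣ S ∣ ≟ k

indepSubsetOf-outside : ∀ (G : Graph (suc n)) x A k →
  IndepSubsetOf G (x ∷ A) k ∘ (outside ∷_) ≐ IndepSubsetOf (dropFirst G) A k
indepSubsetOf-outside G x A k =
  (λ (S⊆ , ind , size) → Equivalence.from out⊆-⇔ S⊆ ,
     (λ i j i∈ j∈ → ind (suc i) (suc j) (there i∈) (there j∈)) , size) ,
  (λ (S⊆ , ind , size) → Equivalence.to out⊆-⇔ S⊆ ,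
     (λ { (suc i) (suc j) (there i∈) (there j∈) → ind i j i∈ j∈ }) , size)

indepSubsetOf-inside : ∀ (G : Graph (suc n)) A k →
  IndepSubsetOf G (inside ∷ A) (suc k) ∘ (inside ∷_) ≐ IndepSubsetOf (dropFirst G) (A ∩ nonNeighbours₀ G) k
indepSubsetOf-inside G A k =
  (λ (S⊆ , ind , size) →
     (λ {j} j∈ → x∈p∩q⁺ (drop-there (S⊆ (there j∈)) ,
                         drop-there (∈-nonNeighbours⁺ G (ind zero (suc j) here (there j∈))))) ,
     (λ i j i∈ j∈ → ind (suc i) (suc j) (there i∈) (there j∈)) ,
     suc-injective size) ,
  (λ (S⊆ , ind , size) → in⊆in (proj₁ ∘ x∈p∩q⁻ A _ ∘ S⊆) , with-0 S⊆ ind , cong suc size)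
  where
  with-0 : ∀ {S} → S ⊆ A ∩ nonNeighbours₀ G → Independent (dropFirst G) S → Independent G (inside ∷ S)
  with-0 S⊆ ind zero zero _ _ = irrefl G zero
  with-0 S⊆ ind zero (suc j) _ (there j∈) = ∈-nonNeighbours⁻ G (there (proj₂ (x∈p∩q⁻ A _ (S⊆ j∈))))
  with-0 S⊆ ind (suc i) zero (there i∈) _ =
    trans (Graph.sym G (suc i) zero) (∈-nonNeighbours⁻ G (there (proj₂ (x∈p∩q⁻ A _ (S⊆ i∈)))))
  with-0 S⊆ ind (suc i) (suc j) (there i∈) (there j∈) = ind i j i∈ j∈

length-filter-indepSubsetOf : ∀ (G : Graph n) A k →
  length (filter (indepSubsetOf? G A k) (allSubsets n)) ≡ indepCountIn G A k
length-filter-indepSubsetOf {zero} G [] k with indepSubsetOf? G [] k []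
length-filter-indepSubsetOf {zero} G [] zero | yes _ = refl
length-filter-indepSubsetOf {zero} G [] zero | no ¬empty = contradiction ((λ ()) , (λ _ _ ()) , refl) ¬empty
length-filter-indepSubsetOf {zero} G [] (suc k) | yes (_ , _ , ())
length-filter-indepSubsetOf {zero} G [] (suc k) | no _ = refl
length-filter-indepSubsetOf {suc n} G (x ∷ A) k = begin
    length (filter P? (allSubsets (suc n)))
  ≡⟨ length-filter-allSubsets n P? ⟩
    length (filter (P? ∘ (outside ∷_)) (allSubsets n)) + length (filter (P? ∘ (inside ∷_)) (allSubsets n))
  ≡⟨ cong (_+ length (filter (P? ∘ (inside ∷_)) (allSubsets n)))
       (trans (cong length (filter-≐ _ _ (indepSubsetOf-outside G x A k) (allSubsets n)))
              (length-filter-indepSubsetOf G′ A k)) ⟩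
    indepCountIn G′ A k + length (filter (P? ∘ (inside ∷_)) (allSubsets n))
  ≡⟨ containing-0 x k ⟩
    indepCountIn G (x ∷ A) k
  ∎
  where
  open ≡-Reasoning
  G′ = dropFirst G
  P? = indepSubsetOf? G (x ∷ A) k
  containing-0 : ∀ x k → indepCountIn G′ A k +
    length (filter (indepSubsetOf? G (x ∷ A) k ∘ (inside ∷_)) (allSubsets n)) ≡ indepCountIn G (x ∷ A) k
  containing-0 x zero = cong (1 +_) (length-filter-none _ (λ { _ (_ , _ , ()) }) (allSubsets n))
  containing-0 outside (suc k) = trans
    (cong (indepCountIn G′ A (suc k) +_)
          (length-filter-none _ (λ _ (S⊆ , _) → case S⊆ here of λ ()) (allSubsets n)))
    (+-identityʳ _)
  containing-0 inside (suc k) = cong (indepCountIn G′ A (suc k) +_)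
    (trans (cong length (filter-≐ _ _ (indepSubsetOf-inside G A k) (allSubsets n)))
           (length-filter-indepSubsetOf G′ (A ∩ nonNeighbours₀ G) k))

readTable : ∀ s {P : ℕ → ℕ → Set} (P? : ∀ x y → Dec (P x y)) →
  {_ : True (allUpTo? (λ x → allUpTo? (λ y → T? (inRanges (a₃Ranges s) x y) →-dec P? x y)
                                      (suc (maxHi (a₃Ranges s))))
                      (length (a₃Ranges s)))} →
  ∀ {x y} → Admissible s x y → P x y
readTable s P? {ok} {x} {y} adm =
  let x< , y≤ = inRanges-bounded (a₃Ranges s) x y adm in toWitness ok x< (s≤s y≤) adm

module _ {n} (G : Graph n) where

  indepCount≡indepCountIn : ∀ k → indepCount G k ≡ indepCountIn G ⊤ k
  indepCount≡indepCountIn k = trans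
    (cong length (filter-≐ _ _ ((λ (ind , size) → (λ {_} → ⊆⊤) , ind , size) ,
                                (λ (_ , ind , size) → ind , size))
                           (allSubsets n)))
    (length-filter-indepSubsetOf G ⊤ k)

  indepCount-1 : indepCount G 1 ≡ n
  indepCount-1 = trans (indepCount≡indepCountIn 1) (trans (indepCountIn-1 G ⊤) (∣⊤∣≡n n))

  module _ (α≡3 : IndependenceNumber G 3) where

    no-independent-4-set : indepCountIn G ⊤ 4 ≡ 0
    no-independent-4-set = trans (sym (indepCount≡indepCountIn 4))
      (length-filter-none _ (λ S (ind , size) → <⇒≱ ≤-refl (subst (_≤ 3) size (proj₂ α≡3 S ind)))
                            (allSubsets n))

    some-independent-3-set : 1 ≤ indepCount G 3
    some-independent-3-set =
      let S , ind , size = proj₁ α≡3 in filter-some _ (lose (∈-allSubsets S) (ind , size))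

    profile-admissible : ∀ {m} → indepCount G 1 ≡ m → m ≤ 8 → Admissible m (indepCount G 2) (indepCount G 3)
    profile-admissible {m} a₁≡m m≤8 =
      subst (λ t → Admissible t (indepCount G 2) (indepCount G 3)) ∣⊤∣≡m
        (subst₂ (Admissible ∣ ⊤ {n} ∣) (sym (indepCount≡indepCountIn 2)) (sym (indepCount≡indepCountIn 3))
          (profiles-admissible 8 ≤-refl G ⊤ (≤-trans (≤-reflexive ∣⊤∣≡m) m≤8) no-independent-4-set))
      where ∣⊤∣≡m = trans (∣⊤∣≡n n) (trans (sym indepCount-1) a₁≡m)

lemma2p8 : ∀ {n : ℕ} (G : Graph n) → IndependenceNumber G 3 →
    (indepCount G 1 ≡ 4 →
        indepCount G 2 < 6 ×
        ((indepCount G 2 ≡ 3 × indepCount G 3 ≡ 1) ⊎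
         (indepCount G 2 ≡ 4 × indepCount G 3 ≡ 1) ⊎
         (indepCount G 2 ≡ 5 × indepCount G 3 ≡ 2))) ×
    (indepCount G 1 ≡ 5 →
        indepCount G 2 < 9 × (indepCount G 2 ≡ 8 → indepCount G 3 ≡ 4)) ×
    (indepCount G 1 ≡ 6 →
        indepCount G 2 < 13 × (indepCount G 2 ≡ 12 → indepCount G 3 ≡ 8)) ×
    (indepCount G 1 ≡ 7 →
        indepCount G 2 < 17 × (indepCount G 2 ≡ 16 → indepCount G 3 ≡ 12)) ×
    (indepCount G 1 ≡ 8 →
        indepCount G 2 < 22 ×
        (indepCount G 2 ≡ 21 → indepCount G 3 ≡ 18) ×
        (indepCount G 2 ≡ 20 → indepCount G 3 ≡ 15 ⊎ indepCount G 3 ≡ 16))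
lemma2p8 G α≡3 =
  (λ a₁≡4 → readTable 4 (λ x y → 1 ≤? y →-dec (x <? 6 ×-dec
                   ((x ≟ 3 ×-dec y ≟ 1) ⊎-dec (x ≟ 4 ×-dec y ≟ 1) ⊎-dec (x ≟ 5 ×-dec y ≟ 2))))
              (profile a₁≡4) (some-independent-3-set G α≡3)) ,
  (λ a₁≡5 → readTable 5 (λ x y → x <? 9 ×-dec (x ≟ 8 →-dec y ≟ 4)) (profile a₁≡5)) ,
  (λ a₁≡6 → readTable 6 (λ x y → x <? 13 ×-dec (x ≟ 12 →-dec y ≟ 8)) (profile a₁≡6)) ,
  (λ a₁≡7 → readTable 7 (λ x y → x <? 17 ×-dec (x ≟ 16 →-dec y ≟ 12)) (profile a₁≡7)) ,
  (λ a₁≡8 → readTable 8 (λ x y → x <? 22 ×-dec (x ≟ 21 →-dec y ≟ 18) ×-dec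
                                               (x ≟ 20 →-dec (y ≟ 15 ⊎-dec y ≟ 16)))
              (profile a₁≡8))
  where
  profile : ∀ {m} → indepCount G 1 ≡ m → {True (m ≤? 8)} → Admissible m (indepCount G 2) (indepCount G 3)
  profile a₁≡m {m≤8} = profile-admissible G α≡3 a₁≡m (toWitness m≤8)
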